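{- Let $r,s\ge1$. Then, as a polynomial identity in $q$, $$\sum_C(q-1)^{r+s-l(C)-1}=\sum_{m=0}^{\min(r-1,s-1)}\binom{r-1}{m}\binom{s-1}{m}q^{r+s-m-1},$$ where the sum runs over all cells $C$ of $\mathcal{T}_{rs}$, including the empty one.
   Context: A cell of $\mathcal{T}_{rs}$ is a (possibly empty) sequence $C=((i_1,j_1),\ldots,(i_l,j_l))$ of distinct pairs in $\{1,\ldots,r\}\times\{1,\ldots,s\}$ with $i_1\le\cdots\le i_l$ and $j_1\le\cdots\le j_l$; $l(C)=l$ is its length. -}

module Defs where

open import Data.Nat as ℕ using (ℕ; zero; suc; _∸_; _⊓_)
open import Data.Nat.Combinatorics using (_C_)
open import Data.Fin using (Fin; toℕ)
open import Data.Fin.Properties as FinP using ()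
open import Data.Product using (_×_; _,_; proj₁; proj₂)
open import Data.Product.Properties using (≡-dec)
open import Data.Product.Relation.Binary.Pointwise.NonDependent using ()
open import Data.List using (List; []; _∷_; map; concatMap; upTo; filter; allFin; cartesianProduct; length)
open import Data.List.Relation.Unary.AllPairs using (AllPairs; allPairs?)
open import Data.Integer as ℤ using (ℤ; +_; _+_; _*_; _-_; _^_)
open import Relation.Binary.PropositionalEquality using (_≡_; _≢_)
open import Relation.Nullary using (Dec; ¬?)
open import Relation.Nullary.Decidable using (_×-dec_)

-- A point of the grid {1..r} × {1..s}, encoded 0-indexed as Fin r × Fin s.
Pt : ℕ → ℕ → Set
Pt r s = Fin r × Fin s

CellRel : ∀ {r s} → Pt r s → Pt r s → Set
CellRel (i , j) (i' , j') = ((i , j) ≢ (i' , j')) × (toℕ i ℕ.≤ toℕ i') × (toℕ j ℕ.≤ toℕ j')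

-- C is a cell of T_rs: a sequence of distinct pairs with i₁ ≤ ⋯ ≤ iₗ and j₁ ≤ ⋯ ≤ jₗ.
IsCell : ∀ {r s} → List (Pt r s) → Set
IsCell = AllPairs CellRel

cellRel? : ∀ {r s} (a b : Pt r s) → Dec (CellRel a b)
cellRel? (i , j) (i' , j') =
  ¬? (≡-dec FinP._≟_ FinP._≟_ (i , j) (i' , j')) ×-dec ((toℕ i ℕ.≤? toℕ i') ×-dec (toℕ j ℕ.≤? toℕ j'))

isCell? : ∀ {r s} (C : List (Pt r s)) → Dec (IsCell C)
isCell? = allPairs? cellRel?

words : ∀ {A : Set} → ℕ → List A → List (List A)
words zero    xs = [] ∷ []
words (suc k) xs = concatMap (λ x → map (x ∷_) (words k xs)) xs

grid : (r s : ℕ) → List (Pt r s)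
grid r s = cartesianProduct (allFin r) (allFin s)

-- All sequences of grid points of length ≤ r·s (each exactly once).
-- A cell has distinct entries, hence length ≤ r·s, so every cell occurs.
sequences : (r s : ℕ) → List (List (Pt r s))
sequences r s = concatMap (λ k → words k (grid r s)) (upTo (suc (r ℕ.* s)))

cells : (r s : ℕ) → List (List (Pt r s))
cells r s = filter isCell? (sequences r s)

sumℤ : List ℤ → ℤ
sumℤ []       = + 0
sumℤ (x ∷ xs) = x + sumℤ xs

lhs : (r s : ℕ) → ℤ → ℤ
lhs r s q = sumℤ (map (λ C → (q - + 1) ^ (r ℕ.+ s ∸ length C ∸ 1)) (cells r s))

rhs : (r s : ℕ) → ℤ → ℤ
rhs r s q = sumℤ (map (λ m → (+ ((r ∸ 1) C m)) * (+ ((s ∸ 1) C m)) * q ^ (r ℕ.+ s ∸ m ∸ 1))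
                      (upTo (suc ((r ∸ 1) ⊓ (s ∸ 1)))))

-- Write x = q - 1. For a point p of the grid with u rows and v columns beyond it, let
-- F p = Σ x^(u+v+1-l(C)) over the cells C starting at p. Removing the first point of a cell
-- gives F p = x^(u+v) + Σ x^(d-1) F y over the points y strictly above p, d being their distance.
-- These points form the rest of the row of p and the rows above it, and the recursion is solved
-- by the P u v with P u 0 = qᵘ, P 0 v = qᵛ and P (u+1) (v+1) = q (P u (v+1) + P (u+1) v - x P u v).
-- With the empty cell, the left-hand side is x^(r+s-1) + Σ x^(i+j) F (i , j) = q P (r-1) (s-1),
-- and Pascal's rule in both binomials gives P u v = Σₘ (u C m) (v C m) q^(u+v-m).

module Submission where

open import Defs
open import Data.Empty using (⊥-elim)
open import Data.Fin.Base using (toℕ)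
import Data.Fin.Properties as Fin
open import Data.Bool.Base using (true; false; if_then_else_)
open import Data.Integer.Base using (ℤ; +_; 0ℤ; 1ℤ; _+_; _*_; _-_; _^_)
import Data.Integer.Properties as ℤ
open import Data.Integer.Tactic.RingSolver using (solve-∀)
open import Data.List.Base using (List; []; _∷_; _++_; map; concatMap; filter; upTo; applyUpTo; tabulate; allFin; cartesianProduct; length)
import Data.List.Properties as List
import Data.List.Relation.Unary.All as All
open import Data.List.Relation.Unary.AllPairs using (_∷_)
open import Data.Nat.Base as ℕ using (ℕ; zero; suc; _∸_; _<_; _≤_; _⊓_; s≤s; z≤n)
import Data.Nat.Properties as ℕ
open import Data.Nat.Combinatorics using (_C_; k>n⇒nCk≡0; nCk+nC[k+1]≡[n+1]C[k+1])
import Data.Nat.Tactic.RingSolver as ℕ-Solver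
open import Data.Product.Base using (_×_; _,_; proj₁; proj₂)
open import Data.Product.Properties using (≡-dec)
open import Data.Sum.Base using (inj₁; inj₂)
open import Function.Base using (_∘_; id)
open import Function.Bundles using (_⇔_; mk⇔; module Equivalence)
open import Relation.Binary.PropositionalEquality
open import Relation.Nullary using (Dec; yes; no; does; ¬_; ¬?)
open import Relation.Nullary.Decidable using (_×-dec_; does-⇔; dec-true; dec-false)
open ≡-Reasoning

private variable A B : Set

infix 6.5 sumOver ∑<
sumOver : (A → ℤ) → List A → ℤ
sumOver f xs = sumℤ (map f xs)
syntax sumOver (λ a → t) xs = ∑[ a ∈ xs ] t

∑< : (ℕ → ℤ) → ℕ → ℤ
∑< f n = ∑[ k ∈ upTo n ] f k
syntax ∑< (λ k → t) n = ∑[ k < n ] t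

∑-cong : {f g : A → ℤ} → (∀ a → f a ≡ g a) → ∀ xs → ∑[ a ∈ xs ] f a ≡ ∑[ a ∈ xs ] g a
∑-cong f≗g xs = cong sumℤ (List.map-cong f≗g xs)

∑-0 : {f : A → ℤ} → (∀ a → f a ≡ 0ℤ) → ∀ xs → ∑[ a ∈ xs ] f a ≡ 0ℤ
∑-0 f≗0 []       = refl
∑-0 f≗0 (x ∷ xs) = cong₂ _+_ (f≗0 x) (∑-0 f≗0 xs)

∑-++ : (f : A → ℤ) (xs ys : List A) → ∑[ a ∈ xs ++ ys ] f a ≡ ∑[ a ∈ xs ] f a + ∑[ a ∈ ys ] f a
∑-++ f []       ys = sym (ℤ.+-identityˡ _)
∑-++ f (x ∷ xs) ys = trans (cong (_+_ (f x)) (∑-++ f xs ys)) (sym (ℤ.+-assoc (f x) _ _))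

∑-+ : (f g : A → ℤ) (xs : List A) → ∑[ a ∈ xs ] (f a + g a) ≡ ∑[ a ∈ xs ] f a + ∑[ a ∈ xs ] g a
∑-+ f g []       = refl
∑-+ f g (x ∷ xs) = trans (cong (_+_ (f x + g x)) (∑-+ f g xs)) (swap (f x) (g x) _ _)
  where swap : ∀ a b c d → a + b + (c + d) ≡ a + c + (b + d)
        swap = solve-∀

∑-sub : (f g : A → ℤ) (xs : List A) → ∑[ a ∈ xs ] (f a - g a) ≡ ∑[ a ∈ xs ] f a - ∑[ a ∈ xs ] g a
∑-sub f g []       = refl
∑-sub f g (x ∷ xs) = trans (cong (_+_ (f x - g x)) (∑-sub f g xs)) (swap (f x) (g x) _ _)
  where swap : ∀ a b c d → a - b + (c - d) ≡ a + c - (b + d)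
        swap = solve-∀

∑-scale : (c : ℤ) (f : A → ℤ) (xs : List A) → ∑[ a ∈ xs ] c * f a ≡ c * (∑[ a ∈ xs ] f a)
∑-scale c f []       = sym (ℤ.*-zeroʳ c)
∑-scale c f (x ∷ xs) = trans (cong (_+_ (c * f x)) (∑-scale c f xs)) (sym (ℤ.*-distribˡ-+ c (f x) _))

∑-map : (f : B → ℤ) (g : A → B) (xs : List A) → ∑[ b ∈ map g xs ] f b ≡ ∑[ a ∈ xs ] f (g a)
∑-map f g xs = cong sumℤ (sym (List.map-∘ {g = f} {f = g} xs))

∑-concatMap : (f : B → ℤ) (g : A → List B) (xs : List A) →
              ∑[ b ∈ concatMap g xs ] f b ≡ ∑[ a ∈ xs ] ∑[ b ∈ g a ] f b
∑-concatMap f g []       = refl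
∑-concatMap f g (x ∷ xs) = trans (∑-++ f (g x) (concatMap g xs)) (cong (_+_ (∑[ b ∈ g x ] f b)) (∑-concatMap f g xs))

𝟙 : {P : Set} → Dec P → ℤ
𝟙 p? = if does p? then 1ℤ else 0ℤ

module _ {P : Set} where

  𝟙-yes : (p? : Dec P) → P → 𝟙 p? ≡ 1ℤ
  𝟙-yes p? p rewrite dec-true p? p = refl

  𝟙-no : (p? : Dec P) → ¬ P → 𝟙 p? ≡ 0ℤ
  𝟙-no p? ¬p rewrite dec-false p? ¬p = refl

  𝟙-⇔ : {Q : Set} → P ⇔ Q → (p? : Dec P) (q? : Dec Q) → 𝟙 p? ≡ 𝟙 q?
  𝟙-⇔ P⇔Q p? q? = cong (λ b → if b then 1ℤ else 0ℤ) (does-⇔ P⇔Q p? q?)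

  𝟙-× : {Q : Set} (p? : Dec P) (q? : Dec Q) → 𝟙 (p? ×-dec q?) ≡ 𝟙 p? * 𝟙 q?
  𝟙-× (yes _) q? = sym (ℤ.*-identityˡ (𝟙 q?))
  𝟙-× (no _)  q? = refl

  𝟙-guard : (p? : Dec P) {a b : ℤ} → (P → a ≡ b) → 𝟙 p? * a ≡ 𝟙 p? * b
  𝟙-guard (yes p) a≡b = cong (1ℤ *_) (a≡b p)
  𝟙-guard (no _)  a≡b = refl

∑-filter : {P : A → Set} (P? : ∀ a → Dec (P a)) (f : A → ℤ) (xs : List A) →
           ∑[ a ∈ filter P? xs ] f a ≡ ∑[ a ∈ xs ] 𝟙 (P? a) * f a
∑-filter P? f [] = refl
∑-filter P? f (x ∷ xs) with does (P? x)
... | true  = cong₂ _+_ (sym (ℤ.*-identityˡ (f x))) (∑-filter P? f xs)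
... | false = trans (∑-filter P? f xs) (sym (trans (cong (_+ ∑[ a ∈ xs ] 𝟙 (P? a) * f a) (ℤ.*-zeroˡ (f x))) (ℤ.+-identityˡ _)))

∑<-suc : (f : ℕ → ℤ) (n : ℕ) → ∑[ k < suc n ] f k ≡ f 0 + ∑[ k < n ] f (suc k)
∑<-suc f n = cong (λ ks → f 0 + sumℤ ks)
  (trans (List.map-applyUpTo suc f n) (sym (List.map-upTo (f ∘ suc) n)))

∑<-+ : (f : ℕ → ℤ) (m n : ℕ) → ∑[ k < m ℕ.+ n ] f k ≡ ∑[ k < m ] f k + ∑[ k < n ] f (m ℕ.+ k)
∑<-+ f zero    n = sym (ℤ.+-identityˡ _)
∑<-+ f (suc m) n = begin
  ∑[ k < suc (m ℕ.+ n) ] f k                                 ≡⟨ ∑<-suc f (m ℕ.+ n) ⟩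
  f 0 + ∑[ k < m ℕ.+ n ] f (suc k)                           ≡⟨ cong (_+_ (f 0)) (∑<-+ (f ∘ suc) m n) ⟩
  f 0 + (∑[ k < m ] f (suc k) + ∑[ k < n ] f (suc m ℕ.+ k))  ≡⟨ ℤ.+-assoc (f 0) _ _ ⟨
  f 0 + ∑[ k < m ] f (suc k) + ∑[ k < n ] f (suc m ℕ.+ k)    ≡⟨ cong (_+ ∑[ k < n ] f (suc m ℕ.+ k)) (∑<-suc f m) ⟨
  ∑[ k < suc m ] f k + ∑[ k < n ] f (suc m ℕ.+ k)            ∎

∑<-shift : (f : ℕ → ℤ) (i n : ℕ) → (∀ k → k < i → f k ≡ 0ℤ) →
           ∑[ k < n ] f k ≡ ∑[ k < n ∸ i ] f (i ℕ.+ k)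
∑<-shift f zero    n       f<i≡0 = refl
∑<-shift f (suc i) zero    f<i≡0 = refl
∑<-shift f (suc i) (suc n) f<i≡0 = begin
  ∑[ k < suc n ] f k             ≡⟨ ∑<-suc f n ⟩
  f 0 + ∑[ k < n ] f (suc k)     ≡⟨ cong₂ _+_ (f<i≡0 0 (s≤s ℕ.z≤n)) (∑<-shift (f ∘ suc) i n (λ k k<i → f<i≡0 (suc k) (s≤s k<i))) ⟩
  0ℤ + ∑[ k < n ∸ i ] f (suc i ℕ.+ k) ≡⟨ ℤ.+-identityˡ _ ⟩
  ∑[ k < n ∸ i ] f (suc i ℕ.+ k) ∎

∑<-telescope : (f g t : ℕ → ℤ) → (∀ k → f k + t (suc k) ≡ g k + t k) →
               ∀ n → ∑[ k < n ] f k + t n ≡ ∑[ k < n ] g k + t 0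
∑<-telescope f g t step zero    = refl
∑<-telescope f g t step (suc n) = begin
  ∑[ k < suc n ] f k + t (suc n)              ≡⟨ cong (_+ t (suc n)) (∑<-suc f n) ⟩
  f 0 + ∑[ k < n ] f (suc k) + t (suc n)      ≡⟨ ℤ.+-assoc (f 0) _ _ ⟩
  f 0 + (∑[ k < n ] f (suc k) + t (suc n))    ≡⟨ cong (_+_ (f 0)) (∑<-telescope (f ∘ suc) (g ∘ suc) (t ∘ suc) (step ∘ suc) n) ⟩
  f 0 + (∑[ k < n ] g (suc k) + t 1)          ≡⟨ swap (f 0) _ (t 1) ⟩
  f 0 + t 1 + ∑[ k < n ] g (suc k)            ≡⟨ cong (_+ ∑[ k < n ] g (suc k)) (step 0) ⟩
  g 0 + t 0 + ∑[ k < n ] g (suc k)            ≡⟨ swap′ (g 0) (t 0) _ ⟩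
  g 0 + ∑[ k < n ] g (suc k) + t 0            ≡⟨ cong (_+ t 0) (∑<-suc g n) ⟨
  ∑[ k < suc n ] g k + t 0                    ∎
  where swap : ∀ a b c → a + (b + c) ≡ a + c + b
        swap = solve-∀
        swap′ : ∀ a b c → a + b + c ≡ a + c + b
        swap′ = solve-∀

_≺_ : ℕ × ℕ → ℕ × ℕ → Set
(i , j) ≺ (a , b) = (i , j) ≢ (a , b) × i ≤ a × j ≤ b

_≺?_ : ∀ p y → Dec (p ≺ y)
(i , j) ≺? (a , b) = ¬? (≡-dec ℕ._≟_ ℕ._≟_ (i , j) (a , b)) ×-dec (i ℕ.≤? a ×-dec j ℕ.≤? b)

≺-trans : ∀ {p y z} → p ≺ y → y ≺ z → p ≺ z
≺-trans (p≢y , i≤a , j≤b) (_ , a≤c , b≤d) =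
  (λ { refl → p≢y (cong₂ _,_ (ℕ.≤-antisym i≤a a≤c) (ℕ.≤-antisym j≤b b≤d)) }) ,
  ℕ.≤-trans i≤a a≤c , ℕ.≤-trans j≤b b≤d

≺⇒0<distance : ∀ {i j a b} → (i , j) ≺ (a , b) → 0 < a ∸ i ℕ.+ (b ∸ j)
≺⇒0<distance {i} {j} {a} {b} (p≢y , i≤a , j≤b) with ℕ.m≤n⇒m<n∨m≡n i≤a
... | inj₁ i<a  = ℕ.≤-trans (ℕ.m<n⇒0<n∸m i<a) (ℕ.m≤m+n (a ∸ i) (b ∸ j))
... | inj₂ refl = ℕ.≤-trans (ℕ.m<n⇒0<n∸m (ℕ.≤∧≢⇒< j≤b (λ j≡b → p≢y (cong (i ,_) j≡b)))) (ℕ.m≤n+m (b ∸ j) (a ∸ i))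

∸-suc-+ : ∀ n m k → n ∸ suc (m ℕ.+ k) ≡ n ∸ suc m ∸ k
∸-suc-+ n m k = sym (ℕ.∸-+-assoc n (suc m) k)

∸-suc-split : ∀ {n i a} → i ≤ a → a < n → n ∸ suc i ≡ a ∸ i ℕ.+ (n ∸ suc a)
∸-suc-split {n} {i} {a} i≤a a<n = begin
  n ∸ suc i                                   ≡⟨ ℕ.m+[n∸m]≡n (ℕ.∸-monoˡ-≤ (suc i) a<n) ⟨
  a ∸ i ℕ.+ (n ∸ suc i ∸ (a ∸ i))             ≡⟨ cong (a ∸ i ℕ.+_) (∸-suc-+ n i (a ∸ i)) ⟨
  a ∸ i ℕ.+ (n ∸ suc (i ℕ.+ (a ∸ i)))         ≡⟨ cong (λ c → a ∸ i ℕ.+ (n ∸ suc c)) (ℕ.m+[n∸m]≡n i≤a) ⟩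
  a ∸ i ℕ.+ (n ∸ suc a)                       ∎

module Horner (x : ℤ) where

  horner : (ℕ → ℤ) → ℕ → ℤ
  horner f zero    = 0ℤ
  horner f (suc n) = f n + x * horner f n

  horner-cong : ∀ {f g} → (∀ k → f k ≡ g k) → ∀ n → horner f n ≡ horner g n
  horner-cong f≗g zero    = refl
  horner-cong f≗g (suc n) = cong₂ (λ a h → a + x * h) (f≗g n) (horner-cong f≗g n)

  horner-head : ∀ f n → horner f (suc n) ≡ f 0 * x ^ n + horner (f ∘ suc) n
  horner-head f zero    = unit x (f 0)
    where unit : ∀ z a → a + z * 0ℤ ≡ a * 1ℤ + 0ℤ
          unit = solve-∀
  horner-head f (suc n) = begin
    f (suc n) + x * horner f (suc n)                         ≡⟨ cong (λ h → f (suc n) + x * h) (horner-head f n) ⟩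
    f (suc n) + x * (f 0 * x ^ n + horner (f ∘ suc) n)       ≡⟨ regroup x (f (suc n)) (f 0) (x ^ n) _ ⟩
    f 0 * (x * x ^ n) + (f (suc n) + x * horner (f ∘ suc) n) ∎
    where regroup : ∀ z a b c d → a + z * (b * c + d) ≡ b * (z * c) + (a + z * d)
          regroup = solve-∀

  horner-forward : ∀ f n → horner f n ≡ ∑[ k < n ] f k * x ^ (n ∸ k ∸ 1)
  horner-forward f zero    = refl
  horner-forward f (suc n) = begin
    horner f (suc n)                                        ≡⟨ horner-head f n ⟩
    f 0 * x ^ n + horner (f ∘ suc) n                        ≡⟨ cong (_+_ (f 0 * x ^ n)) (horner-forward (f ∘ suc) n) ⟩
    f 0 * x ^ n + ∑[ k < n ] f (suc k) * x ^ (n ∸ k ∸ 1)    ≡⟨ ∑<-suc (λ k → f k * x ^ (suc n ∸ k ∸ 1)) n ⟨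
    ∑[ k < suc n ] f k * x ^ (suc n ∸ k ∸ 1)                ∎

  horner-backward : ∀ f n → horner f n ≡ ∑[ k < n ] x ^ k * f (n ∸ suc k)
  horner-backward f zero    = refl
  horner-backward f (suc n) = begin
    f n + x * horner f n                                    ≡⟨ cong₂ (λ a h → a + x * h) (ℤ.*-identityˡ (f n)) (sym (horner-backward f n)) ⟨
    1ℤ * f n + x * (∑[ k < n ] x ^ k * f (n ∸ suc k))       ≡⟨ cong (_+_ (1ℤ * f n)) (∑-scale x (λ k → x ^ k * f (n ∸ suc k)) (upTo n)) ⟨
    1ℤ * f n + ∑[ k < n ] x * (x ^ k * f (n ∸ suc k))       ≡⟨ cong (_+_ (1ℤ * f n)) (∑-cong (λ k → ℤ.*-assoc x (x ^ k) _) (upTo n)) ⟨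
    1ℤ * f n + ∑[ k < n ] x ^ suc k * f (n ∸ suc k)         ≡⟨ ∑<-suc (λ k → x ^ k * f (suc n ∸ suc k)) n ⟨
    ∑[ k < suc n ] x ^ k * f (suc n ∸ suc k)                ∎

  horner-scale : ∀ c f n → horner (λ k → c * f k) n ≡ c * horner f n
  horner-scale c f zero    = sym (ℤ.*-zeroʳ c)
  horner-scale c f (suc n) = begin
    c * f n + x * horner (λ k → c * f k) n   ≡⟨ cong (λ h → c * f n + x * h) (horner-scale c f n) ⟩
    c * f n + x * (c * horner f n)           ≡⟨ factor x c (f n) (horner f n) ⟩
    c * (f n + x * horner f n)               ∎
    where factor : ∀ z c a h → c * a + z * (c * h) ≡ c * (a + z * h)
          factor = solve-∀

  horner-∑ : (ys : List A) (F : A → ℕ → ℤ) (n : ℕ) →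
             horner (λ k → ∑[ y ∈ ys ] F y k) n ≡ ∑[ y ∈ ys ] horner (F y) n
  horner-∑ ys F zero    = sym (∑-0 (λ _ → refl) ys)
  horner-∑ ys F (suc n) = begin
    ∑[ y ∈ ys ] F y n + x * horner (λ k → ∑[ y ∈ ys ] F y k) n   ≡⟨ cong (λ h → ∑[ y ∈ ys ] F y n + x * h) (horner-∑ ys F n) ⟩
    ∑[ y ∈ ys ] F y n + x * (∑[ y ∈ ys ] horner (F y) n)         ≡⟨ cong (_+_ (∑[ y ∈ ys ] F y n)) (∑-scale x (λ y → horner (F y) n) ys) ⟨
    ∑[ y ∈ ys ] F y n + ∑[ y ∈ ys ] x * horner (F y) n           ≡⟨ ∑-+ (λ y → F y n) (λ y → x * horner (F y) n) ys ⟨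
    ∑[ y ∈ ys ] horner (F y) (suc n)                             ∎

  horner-vanish : ∀ f n z → (∀ e → horner f (e ℕ.+ n) ≡ x ^ e * z) → ∀ e → f (e ℕ.+ n) ≡ 0ℤ
  horner-vanish f n z geometric e = begin
    f (e ℕ.+ n)                                          ≡⟨ cancel x (f (e ℕ.+ n)) (x ^ e * z) ⟩
    f (e ℕ.+ n) + x * (x ^ e * z) - x * (x ^ e * z)      ≡⟨ cong (λ h → f (e ℕ.+ n) + x * h - x * (x ^ e * z)) (geometric e) ⟨
    horner f (suc e ℕ.+ n) - x * (x ^ e * z)             ≡⟨ cong (_- x * (x ^ e * z)) (trans (geometric (suc e)) (ℤ.*-assoc x (x ^ e) z)) ⟩
    x * (x ^ e * z) - x * (x ^ e * z)                    ≡⟨ ℤ.+-inverseʳ (x * (x ^ e * z)) ⟩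
    0ℤ                                                   ∎
    where cancel : ∀ y a b → a ≡ a + y * b - y * b
          cancel = solve-∀

  module _ (g : ℕ → ℕ → ℤ) {r s i j : ℕ} (i<r : i < r) (j<s : j < s) where

    private
      u v : ℕ
      u = r ∸ suc i
      v = s ∸ suc j

      summand : ℕ → ℕ → ℤ
      summand a b = 𝟙 ((i , j) ≺? (a , b)) * (x ^ (a ∸ i ℕ.+ (b ∸ j) ∸ 1) * g (r ∸ suc a) (s ∸ suc b))

      row : ℕ → ℤ
      row a = ∑[ b < s ] summand a b

      absent : ∀ {a b} → ¬ (i , j) ≺ (a , b) → summand a b ≡ 0ℤ
      absent {a} {b} ¬≺ = cong (_* (x ^ (a ∸ i ℕ.+ (b ∸ j) ∸ 1) * g (r ∸ suc a) (s ∸ suc b))) (𝟙-no ((i , j) ≺? (a , b)) ¬≺)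

      present : ∀ {a b} → (i , j) ≺ (a , b) → summand a b ≡ x ^ (a ∸ i ℕ.+ (b ∸ j) ∸ 1) * g (r ∸ suc a) (s ∸ suc b)
      present {a} {b} ≺ = trans (cong (_* (x ^ (a ∸ i ℕ.+ (b ∸ j) ∸ 1) * g (r ∸ suc a) (s ∸ suc b))) (𝟙-yes ((i , j) ≺? (a , b)) ≺))
                                (ℤ.*-identityˡ _)

      own-row : row i ≡ horner (g u) v
      own-row = begin
        ∑[ b < s ] summand i b
          ≡⟨ ∑<-shift (summand i) (suc j) s (λ b b≤j → absent (λ (i≢i , _ , j≤b) → i≢i (cong (i ,_) (ℕ.≤-antisym j≤b (ℕ.≤-pred b≤j))))) ⟩
        ∑[ β < v ] summand i (suc j ℕ.+ β)
          ≡⟨ ∑-cong entry (upTo v) ⟩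
        ∑[ β < v ] x ^ β * g u (v ∸ suc β)
          ≡⟨ horner-backward (g u) v ⟨
        horner (g u) v
          ∎
        where
        entry : ∀ β → summand i (suc j ℕ.+ β) ≡ x ^ β * g u (v ∸ suc β)
        entry β rewrite sym (ℕ.+-suc j β) = begin
          summand i (j ℕ.+ suc β)
            ≡⟨ present ((λ eq → ℕ.<⇒≢ (ℕ.m<m+n j (s≤s z≤n)) (cong proj₂ eq)) , ℕ.≤-refl , ℕ.m≤m+n j (suc β)) ⟩
          x ^ (i ∸ i ℕ.+ (j ℕ.+ suc β ∸ j) ∸ 1) * g u (s ∸ suc (j ℕ.+ suc β))
            ≡⟨ cong₂ (λ e c → x ^ (e ∸ 1) * g u c) (cong₂ ℕ._+_ (ℕ.n∸n≡0 i) (ℕ.m+n∸m≡n j (suc β))) (∸-suc-+ s j (suc β)) ⟩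
          x ^ β * g u (v ∸ suc β)
            ∎

      later-row : ∀ α → row (i ℕ.+ suc α) ≡ x ^ α * horner (g (u ∸ suc α)) (suc v)
      later-row α = begin
        ∑[ b < s ] summand (i ℕ.+ suc α) b
          ≡⟨ ∑<-shift (summand (i ℕ.+ suc α)) j s (λ b b<j → absent (λ (_ , _ , j≤b) → ℕ.<⇒≱ b<j j≤b)) ⟩
        ∑[ β < s ∸ j ] summand (i ℕ.+ suc α) (j ℕ.+ β)
          ≡⟨ cong (λ n → ∑[ β < n ] summand (i ℕ.+ suc α) (j ℕ.+ β)) (ℕ.+-∸-assoc 1 j<s) ⟩
        ∑[ β < suc v ] summand (i ℕ.+ suc α) (j ℕ.+ β)
          ≡⟨ ∑-cong entry (upTo (suc v)) ⟩
        ∑[ β < suc v ] x ^ α * (x ^ β * g (u ∸ suc α) (suc v ∸ suc β))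
          ≡⟨ ∑-scale (x ^ α) (λ β → x ^ β * g (u ∸ suc α) (suc v ∸ suc β)) (upTo (suc v)) ⟩
        x ^ α * (∑[ β < suc v ] x ^ β * g (u ∸ suc α) (suc v ∸ suc β))
          ≡⟨ cong (x ^ α *_) (horner-backward (g (u ∸ suc α)) (suc v)) ⟨
        x ^ α * horner (g (u ∸ suc α)) (suc v)
          ∎
        where
        entry : ∀ β → summand (i ℕ.+ suc α) (j ℕ.+ β) ≡ x ^ α * (x ^ β * g (u ∸ suc α) (suc v ∸ suc β))
        entry β = begin
          summand (i ℕ.+ suc α) (j ℕ.+ β)
            ≡⟨ present ((λ eq → ℕ.<⇒≢ (ℕ.m<m+n i (s≤s z≤n)) (cong proj₁ eq)) , ℕ.m≤m+n i (suc α) , ℕ.m≤m+n j β) ⟩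
          x ^ (i ℕ.+ suc α ∸ i ℕ.+ (j ℕ.+ β ∸ j) ∸ 1) * g (r ∸ suc (i ℕ.+ suc α)) (s ∸ suc (j ℕ.+ β))
            ≡⟨ cong (λ e → x ^ (e ∸ 1) * g (r ∸ suc (i ℕ.+ suc α)) (s ∸ suc (j ℕ.+ β))) (cong₂ ℕ._+_ (ℕ.m+n∸m≡n i (suc α)) (ℕ.m+n∸m≡n j β)) ⟩
          x ^ (α ℕ.+ β) * g (r ∸ suc (i ℕ.+ suc α)) (s ∸ suc (j ℕ.+ β))
            ≡⟨ cong₂ (λ c d → x ^ (α ℕ.+ β) * g c d) (∸-suc-+ r i (suc α)) (∸-suc-+ s j β) ⟩
          x ^ (α ℕ.+ β) * g (u ∸ suc α) (suc v ∸ suc β)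
            ≡⟨ cong (_* g (u ∸ suc α) (suc v ∸ suc β)) (ℤ.^-distribˡ-+-* x α β) ⟩
          x ^ α * x ^ β * g (u ∸ suc α) (suc v ∸ suc β)
            ≡⟨ ℤ.*-assoc (x ^ α) (x ^ β) _ ⟩
          x ^ α * (x ^ β * g (u ∸ suc α) (suc v ∸ suc β))
            ∎

    -- The strict upper set of (i , j) is the rest of its row plus the rows above it.
    ∑-above : ∑[ a < r ] ∑[ b < s ] 𝟙 ((i , j) ≺? (a , b)) * (x ^ (a ∸ i ℕ.+ (b ∸ j) ∸ 1) * g (r ∸ suc a) (s ∸ suc b))
              ≡ horner (g (r ∸ suc i)) (s ∸ suc j) + horner (λ a → horner (g a) (suc (s ∸ suc j))) (r ∸ suc i)
    ∑-above = begin
      ∑[ a < r ] row a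
        ≡⟨ ∑<-shift row i r (λ a a<i → ∑-0 (λ b → absent (λ (_ , i≤a , _) → ℕ.<⇒≱ a<i i≤a)) (upTo s)) ⟩
      ∑[ α < r ∸ i ] row (i ℕ.+ α)
        ≡⟨ cong (λ n → ∑[ α < n ] row (i ℕ.+ α)) (ℕ.+-∸-assoc 1 i<r) ⟩
      ∑[ α < suc u ] row (i ℕ.+ α)
        ≡⟨ ∑<-suc (λ α → row (i ℕ.+ α)) u ⟩
      row (i ℕ.+ 0) + ∑[ α < u ] row (i ℕ.+ suc α)
        ≡⟨ cong₂ _+_ (trans (cong row (ℕ.+-identityʳ i)) own-row) (∑-cong later-row (upTo u)) ⟩
      horner (g u) v + ∑[ α < u ] x ^ α * horner (g (u ∸ suc α)) (suc v)
        ≡⟨ cong (_+_ (horner (g u) v)) (horner-backward (λ a → horner (g a) (suc v)) u) ⟨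
      horner (g u) v + horner (λ a → horner (g a) (suc v)) u
        ∎

module Polynomials (q : ℤ) where

  x : ℤ
  x = q - 1ℤ

  open Horner x public

  P : ℕ → ℕ → ℤ
  P zero    v       = q ^ v
  P (suc u) zero    = q ^ suc u
  P (suc u) (suc v) = q * (P u (suc v) + P (suc u) v - x * P u v)

  P-zeroʳ : ∀ u → P u 0 ≡ q ^ u
  P-zeroʳ zero    = refl
  P-zeroʳ (suc u) = refl

  horner-P-zero : ∀ n → horner (P 0) n ≡ q ^ n - x ^ n
  horner-P-zero zero    = refl
  horner-P-zero (suc n) = begin
    q ^ n + x * horner (P 0) n    ≡⟨ cong (λ h → q ^ n + x * h) (horner-P-zero n) ⟩
    q ^ n + x * (q ^ n - x ^ n)   ≡⟨ geometric q (q ^ n) (x ^ n) ⟩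
    q * q ^ n - x * x ^ n         ∎
    where geometric : ∀ q a b → a + (q - 1ℤ) * (a - b) ≡ q * a - (q - 1ℤ) * b
          geometric = solve-∀

  horner-P-suc : ∀ u v → horner (P (suc u)) (suc v) ≡ q * (P (suc u) v - x * P u v)
  horner-P-suc u zero    = begin
    q * q ^ u + x * 0ℤ              ≡⟨ base q (q ^ u) ⟩
    q * (q * q ^ u - x * q ^ u)     ≡⟨ cong (λ a → q * (q * q ^ u - x * a)) (P-zeroʳ u) ⟨
    q * (q * q ^ u - x * P u 0)     ∎
    where base : ∀ q a → q * a + (q - 1ℤ) * 0ℤ ≡ q * (q * a - (q - 1ℤ) * a)
          base = solve-∀
  horner-P-suc u (suc v) = begin
    P (suc u) (suc v) + x * horner (P (suc u)) (suc v)
      ≡⟨ cong (λ h → P (suc u) (suc v) + x * h) (horner-P-suc u v) ⟩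
    q * (P u (suc v) + P (suc u) v - x * P u v) + x * (q * (P (suc u) v - x * P u v))
      ≡⟨ step q (P u (suc v)) (P (suc u) v) (P u v) ⟩
    q * (q * (P u (suc v) + P (suc u) v - x * P u v) - x * P u (suc v))
      ∎
    where step : ∀ q a b c → q * (a + b - (q - 1ℤ) * c) + (q - 1ℤ) * (q * (b - (q - 1ℤ) * c))
                           ≡ q * (q * (a + b - (q - 1ℤ) * c) - (q - 1ℤ) * a)
          step = solve-∀

  horner²-P : ∀ u v → horner (λ a → horner (P a) (suc v)) (suc u) ≡ q * P u v - x ^ suc (u ℕ.+ v)
  horner²-P zero    v = begin
    horner (P 0) (suc v) + x * 0ℤ    ≡⟨ cong (_+ x * 0ℤ) (horner-P-zero (suc v)) ⟩
    q ^ suc v - x ^ suc v + x * 0ℤ   ≡⟨ drop (q ^ suc v - x ^ suc v) x ⟩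
    q ^ suc v - x ^ suc v            ∎
    where drop : ∀ a y → a + y * 0ℤ ≡ a
          drop = solve-∀
  horner²-P (suc u) v = begin
    horner (P (suc u)) (suc v) + x * horner (λ a → horner (P a) (suc v)) (suc u)
      ≡⟨ cong₂ (λ a h → a + x * h) (horner-P-suc u v) (horner²-P u v) ⟩
    q * (P (suc u) v - x * P u v) + x * (q * P u v - x ^ suc (u ℕ.+ v))
      ≡⟨ step q (P (suc u) v) (P u v) (x ^ suc (u ℕ.+ v)) ⟩
    q * P (suc u) v - x * x ^ suc (u ℕ.+ v)
      ∎
    where step : ∀ q a b c → q * (a - (q - 1ℤ) * b) + (q - 1ℤ) * (q * b - c) ≡ q * a - (q - 1ℤ) * c
          step = solve-∀

  P-decomposition : ∀ u v → x ^ (u ℕ.+ v) + horner (P u) v + horner (λ a → horner (P a) (suc v)) u ≡ P u v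
  P-decomposition zero    zero    = refl
  P-decomposition zero    (suc v) = begin
    x ^ suc v + horner (P 0) (suc v) + 0ℤ        ≡⟨ cong (λ h → x ^ suc v + h + 0ℤ) (horner-P-zero (suc v)) ⟩
    x ^ suc v + (q ^ suc v - x ^ suc v) + 0ℤ     ≡⟨ cancel (x ^ suc v) (q ^ suc v) ⟩
    q ^ suc v                                    ∎
    where cancel : ∀ a b → a + (b - a) + 0ℤ ≡ b
          cancel = solve-∀
  P-decomposition (suc u) zero    = begin
    x ^ suc (u ℕ.+ 0) + 0ℤ + horner (λ a → horner (P a) 1) (suc u)   ≡⟨ cong (λ h → x ^ suc (u ℕ.+ 0) + 0ℤ + h) (horner²-P u 0) ⟩
    x ^ suc (u ℕ.+ 0) + 0ℤ + (q * P u 0 - x ^ suc (u ℕ.+ 0))         ≡⟨ cancel (x ^ suc (u ℕ.+ 0)) (q * P u 0) ⟩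
    q * P u 0                                                        ≡⟨ cong (q *_) (P-zeroʳ u) ⟩
    q * q ^ u                                                        ∎
    where cancel : ∀ a b → a + 0ℤ + (b - a) ≡ b
          cancel = solve-∀
  P-decomposition (suc u) (suc v) = begin
    x ^ suc (u ℕ.+ suc v) + horner (P (suc u)) (suc v) + horner (λ a → horner (P a) (suc (suc v))) (suc u)
      ≡⟨ cong₂ (λ a b → x ^ suc (u ℕ.+ suc v) + a + b) (horner-P-suc u v) (horner²-P u (suc v)) ⟩
    x ^ suc (u ℕ.+ suc v) + q * (P (suc u) v - x * P u v) + (q * P u (suc v) - x ^ suc (u ℕ.+ suc v))
      ≡⟨ step q (x ^ suc (u ℕ.+ suc v)) (P u (suc v)) (P (suc u) v) (P u v) ⟩
    q * (P u (suc v) + P (suc u) v - x * P u v)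
      ∎
    where step : ∀ q e a b c → e + q * (b - (q - 1ℤ) * c) + (q * a - e) ≡ q * (a + b - (q - 1ℤ) * c)
          step = solve-∀

  -- coefficient of tᵐ in (q + t)ᵘ
  coeff : ℕ → ℕ → ℤ
  coeff u m = + (u C m) * q ^ (u ∸ m)

  coeff-vanish : ∀ {u m} → u < m → coeff u m ≡ 0ℤ
  coeff-vanish {u} {m} u<m = cong (λ c → + c * q ^ (u ∸ m)) (k>n⇒nCk≡0 u<m)

  coeff-suc-zero : ∀ u → coeff (suc u) 0 ≡ q * coeff u 0
  coeff-suc-zero u = swap q (q ^ u)
    where swap : ∀ q a → 1ℤ * (q * a) ≡ q * (1ℤ * a)
          swap = solve-∀

  coeff-suc-suc : ∀ u m → coeff (suc u) (suc m) ≡ coeff u m + q * coeff u (suc m)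
  coeff-suc-suc u m = begin
    + (suc u C suc m) * q ^ (u ∸ m)                         ≡⟨ cong (λ c → + c * q ^ (u ∸ m)) (nCk+nC[k+1]≡[n+1]C[k+1] u m) ⟨
    + (u C m ℕ.+ u C suc m) * q ^ (u ∸ m)                   ≡⟨ cong (_* q ^ (u ∸ m)) (ℤ.pos-+ (u C m) (u C suc m)) ⟩
    (+ (u C m) + + (u C suc m)) * q ^ (u ∸ m)               ≡⟨ ℤ.*-distribʳ-+ (q ^ (u ∸ m)) (+ (u C m)) (+ (u C suc m)) ⟩
    coeff u m + + (u C suc m) * q ^ (u ∸ m)                 ≡⟨ cong (λ a → coeff u m + a) lower ⟩
    coeff u m + q * coeff u (suc m)                         ∎
    where
    lower : + (u C suc m) * q ^ (u ∸ m) ≡ q * coeff u (suc m)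
    lower with suc m ℕ.≤? u
    ... | yes m<u = trans (cong (λ e → + (u C suc m) * q ^ e) (ℕ.+-∸-assoc 1 m<u))
                          (swap q (+ (u C suc m)) (q ^ (u ∸ suc m)))
      where swap : ∀ q c a → c * (q * a) ≡ q * (c * a)
            swap = solve-∀
    ... | no  m≮u = trans (cong (λ c → + c * q ^ (u ∸ m)) (k>n⇒nCk≡0 (ℕ.≰⇒> m≮u)))
                          (sym (trans (cong (q *_) (coeff-vanish (ℕ.≰⇒> m≮u))) (ℤ.*-zeroʳ q)))

  coeffSum : ℕ → ℕ → ℕ → ℤ
  coeffSum M u v = ∑[ m < M ] coeff u m * + (v C m)

  -- Pascal's rule in both factors; the surplus terms telescope.
  coeffSum-step : ∀ {M} u v → u < M →
    coeffSum (suc M) (suc u) (suc v) ≡ q * coeffSum (suc M) u (suc v) + coeffSum (suc M) (suc u) v - x * coeffSum (suc M) u v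
  coeffSum-step {M} u v u<M = begin
    ∑[ m < suc M ] f m                      ≡⟨ ℤ.+-identityʳ _ ⟨
    ∑[ m < suc M ] f m + 0ℤ                 ≡⟨ cong (λ d → ∑[ m < suc M ] f m + d * + (v C M)) (coeff-vanish u<M) ⟨
    ∑[ m < suc M ] f m + t (suc M)          ≡⟨ ∑<-telescope f g t step (suc M) ⟩
    ∑[ m < suc M ] g m + 0ℤ                 ≡⟨ ℤ.+-identityʳ _ ⟩
    ∑[ m < suc M ] g m                      ≡⟨ ∑-sub (λ m → q * a m + b m) (λ m → x * c m) (upTo (suc M)) ⟩
    ∑[ m < suc M ] (q * a m + b m) - ∑[ m < suc M ] x * c m
                                            ≡⟨ cong₂ _-_ (∑-+ (λ m → q * a m) b (upTo (suc M))) (∑-scale x c (upTo (suc M))) ⟩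
    ∑[ m < suc M ] q * a m + coeffSum (suc M) (suc u) v - x * coeffSum (suc M) u v
                                            ≡⟨ cong (λ s → s + coeffSum (suc M) (suc u) v - x * coeffSum (suc M) u v) (∑-scale q a (upTo (suc M))) ⟩
    q * coeffSum (suc M) u (suc v) + coeffSum (suc M) (suc u) v - x * coeffSum (suc M) u v
                                            ∎
    where
    f a b c g : ℕ → ℤ
    f m = coeff (suc u) m * + (suc v C m)
    a m = coeff u m * + (suc v C m)
    b m = coeff (suc u) m * + (v C m)
    c m = coeff u m * + (v C m)
    g m = q * a m + b m - x * c m
    t : ℕ → ℤ
    t zero    = 0ℤ
    t (suc m) = c m
    step : ∀ m → f m + t (suc m) ≡ g m + t m
    step zero    = begin
      coeff (suc u) 0 * 1ℤ + coeff u 0 * 1ℤ     ≡⟨ cong (λ d → d * 1ℤ + coeff u 0 * 1ℤ) (coeff-suc-zero u) ⟩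
      q * coeff u 0 * 1ℤ + coeff u 0 * 1ℤ       ≡⟨ base q (coeff u 0) ⟩
      q * (coeff u 0 * 1ℤ) + q * coeff u 0 * 1ℤ - x * (coeff u 0 * 1ℤ) + 0ℤ
                                                ≡⟨ cong (λ d → q * (coeff u 0 * 1ℤ) + d * 1ℤ - x * (coeff u 0 * 1ℤ) + 0ℤ) (coeff-suc-zero u) ⟨
      g 0 + 0ℤ                                  ∎
      where base : ∀ q d → q * d * 1ℤ + d * 1ℤ ≡ q * (d * 1ℤ) + q * d * 1ℤ - (q - 1ℤ) * (d * 1ℤ) + 0ℤ
            base = solve-∀
    step (suc m) = begin
      coeff (suc u) (suc m) * + (suc v C suc m) + c (suc m)
        ≡⟨ cong₂ (λ d e → d * e + c (suc m)) (coeff-suc-suc u m) pascal ⟩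
      (coeff u m + q * coeff u (suc m)) * (+ (v C m) + + (v C suc m)) + c (suc m)
        ≡⟨ rearrange q (coeff u m) (coeff u (suc m)) (+ (v C m)) (+ (v C suc m)) ⟩
      q * (coeff u (suc m) * (+ (v C m) + + (v C suc m))) + (coeff u m + q * coeff u (suc m)) * + (v C suc m)
        - x * c (suc m) + c m
        ≡⟨ cong₂ (λ d e → q * (coeff u (suc m) * e) + d * + (v C suc m) - x * c (suc m) + c m) (coeff-suc-suc u m) pascal ⟨
      g (suc m) + t (suc m)
        ∎
      where
      pascal : + (suc v C suc m) ≡ + (v C m) + + (v C suc m)
      pascal = trans (cong +_ (sym (nCk+nC[k+1]≡[n+1]C[k+1] v m))) (ℤ.pos-+ (v C m) (v C suc m))
      rearrange : ∀ q a a′ b b′ → (a + q * a′) * (b + b′) + a′ * b′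
                  ≡ q * (a′ * (b + b′)) + (a + q * a′) * b′ - (q - 1ℤ) * (a′ * b′) + a * b
      rearrange = solve-∀

  P-closed : ∀ u v {M} → u < M → P u v ≡ q ^ v * coeffSum M u v
  P-closed zero    v       {suc M} _ = begin
    q ^ v                            ≡⟨ ℤ.*-identityʳ (q ^ v) ⟨
    q ^ v * (1ℤ + 0ℤ)                ≡⟨ cong (λ s → q ^ v * (1ℤ + s)) (∑-0 tail (upTo M)) ⟨
    q ^ v * (1ℤ + ∑[ m < M ] coeff 0 (suc m) * + (v C suc m))
                                     ≡⟨ cong (q ^ v *_) (∑<-suc (λ m → coeff 0 m * + (v C m)) M) ⟨
    q ^ v * coeffSum (suc M) 0 v     ∎
    where tail : ∀ m → coeff 0 (suc m) * + (v C suc m) ≡ 0ℤ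
          tail m = cong (_* + (v C suc m)) (coeff-vanish {0} {suc m} (s≤s z≤n))
  P-closed (suc u) zero    {suc M} _ = begin
    q ^ suc u                                               ≡⟨ unit (q ^ suc u) ⟩
    1ℤ * (1ℤ * q ^ suc u * 1ℤ + 0ℤ)                         ≡⟨ cong (λ s → 1ℤ * (1ℤ * q ^ suc u * 1ℤ + s)) (∑-0 tail (upTo M)) ⟨
    1ℤ * (1ℤ * q ^ suc u * 1ℤ + ∑[ m < M ] coeff (suc u) (suc m) * + (0 C suc m))
                                                            ≡⟨ cong (1ℤ *_) (∑<-suc (λ m → coeff (suc u) m * + (0 C m)) M) ⟨
    1ℤ * coeffSum (suc M) (suc u) 0                         ∎
    where unit : ∀ a → a ≡ 1ℤ * (1ℤ * a * 1ℤ + 0ℤ)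
          unit = solve-∀
          tail : ∀ m → coeff (suc u) (suc m) * + (0 C suc m) ≡ 0ℤ
          tail m = ℤ.*-zeroʳ (coeff (suc u) (suc m))
  P-closed (suc u) (suc v) {suc M} (s≤s u<M) = begin
    q * (P u (suc v) + P (suc u) v - x * P u v)
      ≡⟨ cong₂ (λ a b → q * (a + b - x * P u v)) (P-closed u (suc v) u<sM) (P-closed (suc u) v (s≤s u<M)) ⟩
    q * (q ^ suc v * coeffSum (suc M) u (suc v) + q ^ v * coeffSum (suc M) (suc u) v - x * P u v)
      ≡⟨ cong (λ c → q * (q ^ suc v * coeffSum (suc M) u (suc v) + q ^ v * coeffSum (suc M) (suc u) v - x * c)) (P-closed u v u<sM) ⟩
    q * (q * q ^ v * coeffSum (suc M) u (suc v) + q ^ v * coeffSum (suc M) (suc u) v - x * (q ^ v * coeffSum (suc M) u v))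
      ≡⟨ factor q (q ^ v) (coeffSum (suc M) u (suc v)) (coeffSum (suc M) (suc u) v) (coeffSum (suc M) u v) ⟩
    q * q ^ v * (q * coeffSum (suc M) u (suc v) + coeffSum (suc M) (suc u) v - x * coeffSum (suc M) u v)
      ≡⟨ cong (q * q ^ v *_) (coeffSum-step u v u<M) ⟨
    q * q ^ v * coeffSum (suc M) (suc u) (suc v)
      ∎
    where
    u<sM : u < suc M
    u<sM = ℕ.m<n⇒m<1+n u<M
    factor : ∀ q e a b c → q * (q * e * a + e * b - (q - 1ℤ) * (e * c)) ≡ q * e * (q * a + b - (q - 1ℤ) * c)
    factor = solve-∀

  rhs-summand : ∀ u v m → + (u C m) * + (v C m) * q ^ (suc u ℕ.+ suc v ∸ m ∸ 1) ≡ q ^ suc v * (coeff u m * + (v C m))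
  rhs-summand u v m with m ℕ.≤? u
  ... | yes m≤u = begin
    + (u C m) * + (v C m) * q ^ (suc u ℕ.+ suc v ∸ m ∸ 1)   ≡⟨ cong (λ e → + (u C m) * + (v C m) * q ^ e) exponent ⟩
    + (u C m) * + (v C m) * q ^ (u ∸ m ℕ.+ suc v)           ≡⟨ cong (+ (u C m) * + (v C m) *_) (ℤ.^-distribˡ-+-* q (u ∸ m) (suc v)) ⟩
    + (u C m) * + (v C m) * (q ^ (u ∸ m) * q ^ suc v)       ≡⟨ swap (+ (u C m)) (+ (v C m)) (q ^ (u ∸ m)) (q ^ suc v) ⟩
    q ^ suc v * (coeff u m * + (v C m))                     ∎
    where
    exponent : suc u ℕ.+ suc v ∸ m ∸ 1 ≡ u ∸ m ℕ.+ suc v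
    exponent = cong (_∸ 1) (trans (ℕ.+-∸-comm (suc v) (ℕ.m≤n⇒m≤1+n m≤u)) (cong (ℕ._+ suc v) (ℕ.+-∸-assoc 1 m≤u)))
    swap : ∀ a b c d → a * b * (c * d) ≡ d * (a * c * b)
    swap = solve-∀
  ... | no m≰u = trans (cong (λ c → + c * + (v C m) * q ^ (suc u ℕ.+ suc v ∸ m ∸ 1)) (k>n⇒nCk≡0 (ℕ.≰⇒> m≰u)))
                       (sym (trans (cong (λ c → q ^ suc v * (c * + (v C m))) (coeff-vanish (ℕ.≰⇒> m≰u))) (ℤ.*-zeroʳ (q ^ suc v))))

  coeffSum-bound : ∀ u v → coeffSum (suc (u ⊓ v)) u v ≡ coeffSum (suc u) u v
  coeffSum-bound u v = begin
    coeffSum (suc (u ⊓ v)) u v            ≡⟨ ℤ.+-identityʳ _ ⟨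
    coeffSum (suc (u ⊓ v)) u v + 0ℤ       ≡⟨ cong (_+_ (coeffSum (suc (u ⊓ v)) u v)) (∑-0 (λ k → vanish (s≤s (ℕ.m≤m+n (u ⊓ v) k))) (upTo (u ∸ u ⊓ v))) ⟨
    coeffSum (suc (u ⊓ v)) u v + ∑[ k < u ∸ u ⊓ v ] coeff u (suc (u ⊓ v) ℕ.+ k) * + (v C (suc (u ⊓ v) ℕ.+ k))
                                          ≡⟨ ∑<-+ (λ m → coeff u m * + (v C m)) (suc (u ⊓ v)) (u ∸ u ⊓ v) ⟨
    coeffSum (suc (u ⊓ v) ℕ.+ (u ∸ u ⊓ v)) u v
                                          ≡⟨ cong (λ M → coeffSum (suc M) u v) (ℕ.m+[n∸m]≡n (ℕ.m⊓n≤m u v)) ⟩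
    coeffSum (suc u) u v                  ∎
    where
    vanish : ∀ {m} → u ⊓ v < m → coeff u m * + (v C m) ≡ 0ℤ
    vanish {m} u⊓v<m with ℕ.⊓-sel u v
    ... | inj₁ u⊓v≡u = cong (_* + (v C m)) (coeff-vanish (subst (_< m) u⊓v≡u u⊓v<m))
    ... | inj₂ u⊓v≡v = trans (cong (λ c → coeff u m * + c) (k>n⇒nCk≡0 (subst (_< m) u⊓v≡v u⊓v<m))) (ℤ.*-zeroʳ (coeff u m))

  rhs-closed : ∀ u v → rhs (suc u) (suc v) q ≡ q * P u v
  rhs-closed u v = begin
    ∑[ m < suc (u ⊓ v) ] + (u C m) * + (v C m) * q ^ (suc u ℕ.+ suc v ∸ m ∸ 1)
      ≡⟨ ∑-cong (rhs-summand u v) (upTo (suc (u ⊓ v))) ⟩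
    ∑[ m < suc (u ⊓ v) ] q ^ suc v * (coeff u m * + (v C m))
      ≡⟨ ∑-scale (q ^ suc v) (λ m → coeff u m * + (v C m)) (upTo (suc (u ⊓ v))) ⟩
    q ^ suc v * coeffSum (suc (u ⊓ v)) u v
      ≡⟨ cong (q ^ suc v *_) (coeffSum-bound u v) ⟩
    q * q ^ v * coeffSum (suc u) u v
      ≡⟨ ℤ.*-assoc q (q ^ v) _ ⟩
    q * (q ^ v * coeffSum (suc u) u v)
      ≡⟨ cong (q *_) (P-closed u v ℕ.≤-refl) ⟨
    q * P u v
      ∎

∑-cartesianProduct : (f : A × B → ℤ) (xs : List A) (ys : List B) →
  ∑[ p ∈ cartesianProduct xs ys ] f p ≡ ∑[ a ∈ xs ] ∑[ b ∈ ys ] f (a , b)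
∑-cartesianProduct f []       ys = refl
∑-cartesianProduct f (a ∷ xs) ys =
  trans (∑-++ f (map (a ,_) ys) (cartesianProduct xs ys))
        (cong₂ _+_ (∑-map f (a ,_) ys) (∑-cartesianProduct f xs ys))

∑-allFin : ∀ n (h : ℕ → ℤ) → ∑[ i ∈ allFin n ] h (toℕ i) ≡ ∑[ k < n ] h k
∑-allFin n h = cong sumℤ (begin
  map (h ∘ toℕ) (tabulate id)   ≡⟨ List.map-tabulate id (h ∘ toℕ) ⟩
  tabulate (h ∘ toℕ)            ≡⟨ tabulate-toℕ n h ⟩
  applyUpTo h n                 ≡⟨ List.map-upTo h n ⟨
  map h (upTo n)                ∎)
  where
  tabulate-toℕ : ∀ n (h : ℕ → ℤ) → tabulate {n = n} (h ∘ toℕ) ≡ applyUpTo h n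
  tabulate-toℕ zero    h = refl
  tabulate-toℕ (suc n) h = cong (h 0 ∷_) (tabulate-toℕ n (h ∘ suc))

∑-grid : ∀ r s (F : ℕ → ℕ → ℤ) →
  ∑[ p ∈ grid r s ] F (toℕ (proj₁ p)) (toℕ (proj₂ p)) ≡ ∑[ a < r ] ∑[ b < s ] F a b
∑-grid r s F = begin
  ∑[ p ∈ grid r s ] F (toℕ (proj₁ p)) (toℕ (proj₂ p))       ≡⟨ ∑-cartesianProduct _ (allFin r) (allFin s) ⟩
  ∑[ i ∈ allFin r ] ∑[ j ∈ allFin s ] F (toℕ i) (toℕ j)     ≡⟨ ∑-cong (λ i → ∑-allFin s (F (toℕ i))) (allFin r) ⟩
  ∑[ i ∈ allFin r ] ∑[ b < s ] F (toℕ i) b                  ≡⟨ ∑-allFin r (λ a → ∑[ b < s ] F a b) ⟩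
  ∑[ a < r ] ∑[ b < s ] F a b                               ∎

∑-words-suc : ∀ k (xs : List A) (f : List A → ℤ) →
  ∑[ w ∈ words (suc k) xs ] f w ≡ ∑[ y ∈ xs ] ∑[ w ∈ words k xs ] f (y ∷ w)
∑-words-suc k xs f = trans (∑-concatMap f (λ y → map (y ∷_) (words k xs)) xs)
                           (∑-cong (λ y → ∑-map f (y ∷_) (words k xs)) xs)

∑-words-length : ∀ k (xs : List A) (f : ℕ → List A → ℤ) →
  ∑[ w ∈ words k xs ] f (length w) w ≡ ∑[ w ∈ words k xs ] f k w
∑-words-length zero    xs f = refl
∑-words-length (suc k) xs f = begin
  ∑[ w ∈ words (suc k) xs ] f (length w) w                 ≡⟨ ∑-words-suc k xs (λ w → f (length w) w) ⟩
  ∑[ y ∈ xs ] ∑[ w ∈ words k xs ] f (suc (length w)) (y ∷ w)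
                                                           ≡⟨ ∑-cong (λ y → ∑-words-length k xs (λ n w → f (suc n) (y ∷ w))) xs ⟩
  ∑[ y ∈ xs ] ∑[ w ∈ words k xs ] f (suc k) (y ∷ w)        ≡⟨ ∑-words-suc k xs (f (suc k)) ⟨
  ∑[ w ∈ words (suc k) xs ] f (suc k) w                    ∎

coords : ∀ {r s} → Pt r s → ℕ × ℕ
coords p = toℕ (proj₁ p) , toℕ (proj₂ p)

CellRel⇔≺ : ∀ {r s} {p y : Pt r s} → CellRel p y ⇔ coords p ≺ coords y
CellRel⇔≺ = mk⇔ (λ (p≢y , ≤s) → (λ eq → p≢y (coords-injective eq)) , ≤s)
                (λ (p≢y , ≤s) → (λ eq → p≢y (cong coords eq)) , ≤s)
  where
  coords-injective : ∀ {r s} {p y : Pt r s} → coords p ≡ coords y → p ≡ y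
  coords-injective eq = cong₂ _,_ (Fin.toℕ-injective (cong proj₁ eq)) (Fin.toℕ-injective (cong proj₂ eq))

CellRel-trans : ∀ {r s} {p y z : Pt r s} → CellRel p y → CellRel y z → CellRel p z
CellRel-trans p≺y y≺z = Equivalence.from CellRel⇔≺ (≺-trans (Equivalence.to CellRel⇔≺ p≺y) (Equivalence.to CellRel⇔≺ y≺z))

isCell-∷-∷ : ∀ {r s} {p y : Pt r s} {w} → IsCell (p ∷ y ∷ w) ⇔ (CellRel p y × IsCell (y ∷ w))
isCell-∷-∷ = mk⇔ (λ { ((p≺y All.∷ _) ∷ y∷w) → p≺y , y∷w })
                 (λ { (p≺y , y∷w@(y≺w ∷ _)) → (p≺y All.∷ All.map (CellRel-trans p≺y) y≺w) ∷ y∷w })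

module Cells (r s : ℕ) (q : ℤ) where
  open Polynomials q

  G : List (Pt r s)
  G = grid r s

  #cells : ℕ → ℤ
  #cells k = ∑[ w ∈ words k G ] 𝟙 (isCell? w)

  #cellsFrom : ℕ → Pt r s → ℤ
  #cellsFrom k p = ∑[ w ∈ words k G ] 𝟙 (isCell? (p ∷ w))

  #cells-suc : ∀ k → #cells (suc k) ≡ ∑[ y ∈ G ] #cellsFrom k y
  #cells-suc k = ∑-words-suc k G (λ w → 𝟙 (isCell? w))

  #cellsFrom-suc : ∀ k p → #cellsFrom (suc k) p ≡ ∑[ y ∈ G ] 𝟙 (cellRel? p y) * #cellsFrom k y
  #cellsFrom-suc k p = begin
    #cellsFrom (suc k) p
      ≡⟨ ∑-words-suc k G (λ w → 𝟙 (isCell? (p ∷ w))) ⟩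
    ∑[ y ∈ G ] ∑[ w ∈ words k G ] 𝟙 (isCell? (p ∷ y ∷ w))
      ≡⟨ ∑-cong (λ y → ∑-cong (λ w → trans (𝟙-⇔ isCell-∷-∷ (isCell? (p ∷ y ∷ w)) (cellRel? p y ×-dec isCell? (y ∷ w)))
                                          (𝟙-× (cellRel? p y) (isCell? (y ∷ w)))) (words k G)) G ⟩
    ∑[ y ∈ G ] ∑[ w ∈ words k G ] 𝟙 (cellRel? p y) * 𝟙 (isCell? (y ∷ w))
      ≡⟨ ∑-cong (λ y → ∑-scale (𝟙 (cellRel? p y)) (λ w → 𝟙 (isCell? (y ∷ w))) (words k G)) G ⟩
    ∑[ y ∈ G ] 𝟙 (cellRel? p y) * #cellsFrom k y
      ∎

  rowsAfter colsAfter : Pt r s → ℕ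
  rowsAfter p = r ∸ suc (toℕ (proj₁ p))
  colsAfter p = s ∸ suc (toℕ (proj₂ p))

  rank : Pt r s → ℕ
  rank p = rowsAfter p ℕ.+ colsAfter p

  distance : Pt r s → Pt r s → ℕ
  distance p y = toℕ (proj₁ y) ∸ toℕ (proj₁ p) ℕ.+ (toℕ (proj₂ y) ∸ toℕ (proj₂ p))

  P-above : ∀ p → x ^ rank p
                  + ∑[ y ∈ G ] 𝟙 (cellRel? p y) * (x ^ (distance p y ∸ 1) * P (rowsAfter y) (colsAfter y))
                ≡ P (rowsAfter p) (colsAfter p)
  P-above p = begin
    x ^ (u ℕ.+ v) + ∑[ y ∈ G ] 𝟙 (cellRel? p y) * weight y
      ≡⟨ cong (_+_ (x ^ (u ℕ.+ v))) (∑-cong (λ y → cong (_* weight y) (𝟙-⇔ CellRel⇔≺ (cellRel? p y) (coords p ≺? coords y))) G) ⟩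
    x ^ (u ℕ.+ v) + ∑[ y ∈ G ] 𝟙 (coords p ≺? coords y) * weight y
      ≡⟨ cong (_+_ (x ^ (u ℕ.+ v))) (∑-grid r s (λ a b → 𝟙 ((i , j) ≺? (a , b)) * (x ^ (a ∸ i ℕ.+ (b ∸ j) ∸ 1) * P (r ∸ suc a) (s ∸ suc b)))) ⟩
    x ^ (u ℕ.+ v) + ∑[ a < r ] ∑[ b < s ] 𝟙 ((i , j) ≺? (a , b)) * (x ^ (a ∸ i ℕ.+ (b ∸ j) ∸ 1) * P (r ∸ suc a) (s ∸ suc b))
      ≡⟨ cong (_+_ (x ^ (u ℕ.+ v))) (∑-above P (Fin.toℕ<n (proj₁ p)) (Fin.toℕ<n (proj₂ p))) ⟩
    x ^ (u ℕ.+ v) + (horner (P u) v + horner (λ a → horner (P a) (suc v)) u)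
      ≡⟨ ℤ.+-assoc (x ^ (u ℕ.+ v)) _ _ ⟨
    x ^ (u ℕ.+ v) + horner (P u) v + horner (λ a → horner (P a) (suc v)) u
      ≡⟨ P-decomposition u v ⟩
    P u v
      ∎
    where
    i = toℕ (proj₁ p)
    j = toℕ (proj₂ p)
    u = rowsAfter p
    v = colsAfter p
    weight : Pt r s → ℤ
    weight y = x ^ (distance p y ∸ 1) * P (rowsAfter y) (colsAfter y)

  rank-step : ∀ {p y} → CellRel p y → rank p ≡ distance p y ∸ 1 ℕ.+ suc (rank y)
  rank-step {p} {y} p≺y@(_ , i≤a , j≤b) = begin
    rank p
      ≡⟨ cong₂ ℕ._+_ (∸-suc-split i≤a (Fin.toℕ<n (proj₁ y))) (∸-suc-split j≤b (Fin.toℕ<n (proj₂ y))) ⟩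
    (toℕ (proj₁ y) ∸ toℕ (proj₁ p) ℕ.+ rowsAfter y) ℕ.+ (toℕ (proj₂ y) ∸ toℕ (proj₂ p) ℕ.+ colsAfter y)
      ≡⟨ interchange (toℕ (proj₁ y) ∸ toℕ (proj₁ p)) (rowsAfter y) (toℕ (proj₂ y) ∸ toℕ (proj₂ p)) (colsAfter y) ⟩
    distance p y ℕ.+ rank y
      ≡⟨ shift-one (≺⇒0<distance (Equivalence.to CellRel⇔≺ p≺y)) ⟩
    distance p y ∸ 1 ℕ.+ suc (rank y)
      ∎
    where
    interchange : ∀ a b c d → a ℕ.+ b ℕ.+ (c ℕ.+ d) ≡ a ℕ.+ c ℕ.+ (b ℕ.+ d)
    interchange = ℕ-Solver.solve-∀
    shift-one : ∀ {d} {m} → 0 < d → d ℕ.+ m ≡ d ∸ 1 ℕ.+ suc m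
    shift-one {suc d} {m} _ = sym (ℕ.+-suc d m)

  #cellsFrom-horner : ∀ B e p → B ≡ e ℕ.+ suc (rank p) →
                      horner (λ k → #cellsFrom k p) B ≡ x ^ e * P (rowsAfter p) (colsAfter p)
  #cellsFrom-horner zero    e p eq = ⊥-elim (ℕ.0≢1+n (trans eq (ℕ.+-suc e _)))
  #cellsFrom-horner (suc B) e p eq = begin
    horner (λ k → #cellsFrom k p) (suc B)
      ≡⟨ horner-head (λ k → #cellsFrom k p) B ⟩
    1ℤ * x ^ B + horner (λ k → #cellsFrom (suc k) p) B
      ≡⟨ cong₂ _+_ (ℤ.*-identityˡ (x ^ B)) (horner-cong (λ k → #cellsFrom-suc k p) B) ⟩
    x ^ B + horner (λ k → ∑[ y ∈ G ] 𝟙 (cellRel? p y) * #cellsFrom k y) B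
      ≡⟨ cong (_+_ (x ^ B)) (horner-∑ G (λ y k → 𝟙 (cellRel? p y) * #cellsFrom k y) B) ⟩
    x ^ B + ∑[ y ∈ G ] horner (λ k → 𝟙 (cellRel? p y) * #cellsFrom k y) B
      ≡⟨ cong (_+_ (x ^ B)) (∑-cong (λ y → horner-scale (𝟙 (cellRel? p y)) (λ k → #cellsFrom k y) B) G) ⟩
    x ^ B + ∑[ y ∈ G ] 𝟙 (cellRel? p y) * horner (λ k → #cellsFrom k y) B
      ≡⟨ cong (_+_ (x ^ B)) (∑-cong (λ y → 𝟙-guard (cellRel? p y) (later y)) G) ⟩
    x ^ B + ∑[ y ∈ G ] 𝟙 (cellRel? p y) * (x ^ e * weight y)
      ≡⟨ cong (_+_ (x ^ B)) (∑-cong (λ y → swap (𝟙 (cellRel? p y)) (x ^ e) (weight y)) G) ⟩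
    x ^ B + ∑[ y ∈ G ] x ^ e * (𝟙 (cellRel? p y) * weight y)
      ≡⟨ cong₂ _+_ (trans (cong (x ^_) B≡e+ρ) (ℤ.^-distribˡ-+-* x e ρ)) (∑-scale (x ^ e) (λ y → 𝟙 (cellRel? p y) * weight y) G) ⟩
    x ^ e * x ^ ρ + x ^ e * (∑[ y ∈ G ] 𝟙 (cellRel? p y) * weight y)
      ≡⟨ ℤ.*-distribˡ-+ (x ^ e) (x ^ ρ) _ ⟨
    x ^ e * (x ^ ρ + ∑[ y ∈ G ] 𝟙 (cellRel? p y) * weight y)
      ≡⟨ cong (x ^ e *_) (P-above p) ⟩
    x ^ e * P (rowsAfter p) (colsAfter p)
      ∎
    where
    ρ = rank p
    B≡e+ρ : B ≡ e ℕ.+ ρ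
    B≡e+ρ = ℕ.suc-injective (trans eq (ℕ.+-suc e ρ))
    weight : Pt r s → ℤ
    weight y = x ^ (distance p y ∸ 1) * P (rowsAfter y) (colsAfter y)
    later : ∀ y → CellRel p y → horner (λ k → #cellsFrom k y) B ≡ x ^ e * weight y
    later y p≺y = begin
      horner (λ k → #cellsFrom k y) B
        ≡⟨ #cellsFrom-horner B (e ℕ.+ (distance p y ∸ 1)) y
             (trans B≡e+ρ (trans (cong (e ℕ.+_) (rank-step p≺y)) (sym (ℕ.+-assoc e _ _)))) ⟩
      x ^ (e ℕ.+ (distance p y ∸ 1)) * P (rowsAfter y) (colsAfter y)
        ≡⟨ cong (_* P (rowsAfter y) (colsAfter y)) (ℤ.^-distribˡ-+-* x e (distance p y ∸ 1)) ⟩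
      x ^ e * x ^ (distance p y ∸ 1) * P (rowsAfter y) (colsAfter y)
        ≡⟨ ℤ.*-assoc (x ^ e) _ _ ⟩
      x ^ e * weight y
        ∎
    swap : ∀ a b c → a * (b * c) ≡ b * (a * c)
    swap = solve-∀

  ∑-corner : ∑[ y ∈ G ] x ^ (toℕ (proj₁ y) ℕ.+ toℕ (proj₂ y)) * P (rowsAfter y) (colsAfter y)
             ≡ horner (λ a → horner (P a) s) r
  ∑-corner = begin
    ∑[ y ∈ G ] x ^ (toℕ (proj₁ y) ℕ.+ toℕ (proj₂ y)) * P (rowsAfter y) (colsAfter y)
      ≡⟨ ∑-grid r s (λ a b → x ^ (a ℕ.+ b) * P (r ∸ suc a) (s ∸ suc b)) ⟩
    ∑[ a < r ] ∑[ b < s ] x ^ (a ℕ.+ b) * P (r ∸ suc a) (s ∸ suc b)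
      ≡⟨ ∑-cong row (upTo r) ⟩
    ∑[ a < r ] x ^ a * horner (P (r ∸ suc a)) s
      ≡⟨ horner-backward (λ a → horner (P a) s) r ⟨
    horner (λ a → horner (P a) s) r
      ∎
    where
    row : ∀ a → ∑[ b < s ] x ^ (a ℕ.+ b) * P (r ∸ suc a) (s ∸ suc b) ≡ x ^ a * horner (P (r ∸ suc a)) s
    row a = begin
      ∑[ b < s ] x ^ (a ℕ.+ b) * P (r ∸ suc a) (s ∸ suc b)
        ≡⟨ ∑-cong (λ b → trans (cong (_* P (r ∸ suc a) (s ∸ suc b)) (ℤ.^-distribˡ-+-* x a b)) (ℤ.*-assoc (x ^ a) (x ^ b) _)) (upTo s) ⟩
      ∑[ b < s ] x ^ a * (x ^ b * P (r ∸ suc a) (s ∸ suc b))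
        ≡⟨ ∑-scale (x ^ a) (λ b → x ^ b * P (r ∸ suc a) (s ∸ suc b)) (upTo s) ⟩
      x ^ a * (∑[ b < s ] x ^ b * P (r ∸ suc a) (s ∸ suc b))
        ≡⟨ cong (x ^ a *_) (horner-backward (P (r ∸ suc a)) s) ⟨
      x ^ a * horner (P (r ∸ suc a)) s
        ∎

  lhs-by-length : lhs r s q ≡ ∑[ k < suc (r ℕ.* s) ] #cells k * x ^ (r ℕ.+ s ∸ k ∸ 1)
  lhs-by-length = begin
    ∑[ C ∈ cells r s ] x ^ (r ℕ.+ s ∸ length C ∸ 1)
      ≡⟨ ∑-filter isCell? (λ C → x ^ (r ℕ.+ s ∸ length C ∸ 1)) (sequences r s) ⟩
    ∑[ C ∈ sequences r s ] 𝟙 (isCell? C) * x ^ (r ℕ.+ s ∸ length C ∸ 1)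
      ≡⟨ ∑-concatMap (λ C → 𝟙 (isCell? C) * x ^ (r ℕ.+ s ∸ length C ∸ 1)) (λ k → words k G) (upTo (suc (r ℕ.* s))) ⟩
    ∑[ k < suc (r ℕ.* s) ] ∑[ w ∈ words k G ] 𝟙 (isCell? w) * x ^ (r ℕ.+ s ∸ length w ∸ 1)
      ≡⟨ ∑-cong (λ k → trans (∑-words-length k G (λ l w → 𝟙 (isCell? w) * x ^ (r ℕ.+ s ∸ l ∸ 1))) (weigh k)) (upTo (suc (r ℕ.* s))) ⟩
    ∑[ k < suc (r ℕ.* s) ] #cells k * x ^ (r ℕ.+ s ∸ k ∸ 1)
      ∎
    where
    weigh : ∀ k → ∑[ w ∈ words k G ] 𝟙 (isCell? w) * x ^ (r ℕ.+ s ∸ k ∸ 1) ≡ #cells k * x ^ (r ℕ.+ s ∸ k ∸ 1)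
    weigh k = begin
      ∑[ w ∈ words k G ] 𝟙 (isCell? w) * x ^ (r ℕ.+ s ∸ k ∸ 1)   ≡⟨ ∑-cong (λ w → ℤ.*-comm (𝟙 (isCell? w)) _) (words k G) ⟩
      ∑[ w ∈ words k G ] x ^ (r ℕ.+ s ∸ k ∸ 1) * 𝟙 (isCell? w)   ≡⟨ ∑-scale (x ^ (r ℕ.+ s ∸ k ∸ 1)) (λ w → 𝟙 (isCell? w)) (words k G) ⟩
      x ^ (r ℕ.+ s ∸ k ∸ 1) * #cells k                           ≡⟨ ℤ.*-comm (x ^ (r ℕ.+ s ∸ k ∸ 1)) (#cells k) ⟩
      #cells k * x ^ (r ℕ.+ s ∸ k ∸ 1)                           ∎

module Count (R S : ℕ) (q : ℤ) where
  open Polynomials q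
  open Cells (suc R) (suc S) q

  corner-rank : ∀ y → R ℕ.+ suc S ≡ toℕ (proj₁ y) ℕ.+ toℕ (proj₂ y) ℕ.+ suc (rank y)
  corner-rank y = begin
    R ℕ.+ suc S
      ≡⟨ cong₂ (λ m k → m ℕ.+ suc k) (ℕ.m+[n∸m]≡n (ℕ.≤-pred (Fin.toℕ<n (proj₁ y)))) (ℕ.m+[n∸m]≡n (ℕ.≤-pred (Fin.toℕ<n (proj₂ y)))) ⟨
    a ℕ.+ (R ∸ a) ℕ.+ suc (b ℕ.+ (S ∸ b))
      ≡⟨ regroup a (R ∸ a) b (S ∸ b) ⟩
    a ℕ.+ b ℕ.+ suc (rank y)
      ∎
    where
    a = toℕ (proj₁ y)
    b = toℕ (proj₂ y)
    regroup : ∀ a m b k → a ℕ.+ m ℕ.+ suc (b ℕ.+ k) ≡ a ℕ.+ b ℕ.+ suc (m ℕ.+ k)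
    regroup = ℕ-Solver.solve-∀

  #cells-horner : ∀ e → horner #cells (e ℕ.+ (suc R ℕ.+ suc S)) ≡ x ^ e * (q * P R S)
  #cells-horner e = begin
    horner #cells (e ℕ.+ (suc R ℕ.+ suc S))
      ≡⟨ cong (horner #cells) (ℕ.+-suc e (R ℕ.+ suc S)) ⟩
    horner #cells (suc n)
      ≡⟨ horner-head #cells n ⟩
    1ℤ * x ^ n + horner (#cells ∘ suc) n
      ≡⟨ cong₂ _+_ (ℤ.*-identityˡ (x ^ n)) (trans (horner-cong #cells-suc n) (horner-∑ G (λ y k → #cellsFrom k y) n)) ⟩
    x ^ n + ∑[ y ∈ G ] horner (λ k → #cellsFrom k y) n
      ≡⟨ cong (_+_ (x ^ n)) (∑-cong from-corner G) ⟩
    x ^ n + ∑[ y ∈ G ] x ^ e * (x ^ (toℕ (proj₁ y) ℕ.+ toℕ (proj₂ y)) * P (rowsAfter y) (colsAfter y))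
      ≡⟨ cong₂ _+_ (ℤ.^-distribˡ-+-* x e (R ℕ.+ suc S)) (∑-scale (x ^ e) _ G) ⟩
    x ^ e * x ^ (R ℕ.+ suc S) + x ^ e * (∑[ y ∈ G ] x ^ (toℕ (proj₁ y) ℕ.+ toℕ (proj₂ y)) * P (rowsAfter y) (colsAfter y))
      ≡⟨ ℤ.*-distribˡ-+ (x ^ e) _ _ ⟨
    x ^ e * (x ^ (R ℕ.+ suc S) + ∑[ y ∈ G ] x ^ (toℕ (proj₁ y) ℕ.+ toℕ (proj₂ y)) * P (rowsAfter y) (colsAfter y))
      ≡⟨ cong (λ t → x ^ e * (x ^ (R ℕ.+ suc S) + t)) (trans ∑-corner (horner²-P R S)) ⟩
    x ^ e * (x ^ (R ℕ.+ suc S) + (q * P R S - x ^ suc (R ℕ.+ S)))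
      ≡⟨ cong (λ m → x ^ e * (x ^ m + (q * P R S - x ^ suc (R ℕ.+ S)))) (ℕ.+-suc R S) ⟩
    x ^ e * (x ^ suc (R ℕ.+ S) + (q * P R S - x ^ suc (R ℕ.+ S)))
      ≡⟨ cong (x ^ e *_) (cancel (x ^ suc (R ℕ.+ S)) (q * P R S)) ⟩
    x ^ e * (q * P R S)
      ∎
    where
    n = e ℕ.+ (R ℕ.+ suc S)
    cancel : ∀ a b → a + (b - a) ≡ b
    cancel = solve-∀
    from-corner : ∀ y → horner (λ k → #cellsFrom k y) n
                        ≡ x ^ e * (x ^ (toℕ (proj₁ y) ℕ.+ toℕ (proj₂ y)) * P (rowsAfter y) (colsAfter y))
    from-corner y = begin
      horner (λ k → #cellsFrom k y) n
        ≡⟨ #cellsFrom-horner n (e ℕ.+ d) y (trans (cong (e ℕ.+_) (corner-rank y)) (sym (ℕ.+-assoc e d _))) ⟩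
      x ^ (e ℕ.+ d) * P (rowsAfter y) (colsAfter y)
        ≡⟨ cong (_* P (rowsAfter y) (colsAfter y)) (ℤ.^-distribˡ-+-* x e d) ⟩
      x ^ e * x ^ d * P (rowsAfter y) (colsAfter y)
        ≡⟨ ℤ.*-assoc (x ^ e) _ _ ⟩
      x ^ e * (x ^ d * P (rowsAfter y) (colsAfter y))
        ∎
      where d = toℕ (proj₁ y) ℕ.+ toℕ (proj₂ y)

  -- The enumeration runs over lengths up to r·s, but no cell is longer than r + s - 1.
  lhs≡ : lhs (suc R) (suc S) q ≡ q * P R S
  lhs≡ = begin
    lhs r s q
      ≡⟨ lhs-by-length ⟩
    ∑[ k < suc (r ℕ.* s) ] #cells k * x ^ (r ℕ.+ s ∸ k ∸ 1)
      ≡⟨ cong (λ m → ∑[ k < m ] #cells k * x ^ (r ℕ.+ s ∸ k ∸ 1)) (size R S) ⟩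
    ∑[ k < r ℕ.+ s ℕ.+ R ℕ.* S ] #cells k * x ^ (r ℕ.+ s ∸ k ∸ 1)
      ≡⟨ ∑<-+ (λ k → #cells k * x ^ (r ℕ.+ s ∸ k ∸ 1)) (r ℕ.+ s) (R ℕ.* S) ⟩
    ∑[ k < r ℕ.+ s ] #cells k * x ^ (r ℕ.+ s ∸ k ∸ 1) + ∑[ k < R ℕ.* S ] #cells (r ℕ.+ s ℕ.+ k) * x ^ (r ℕ.+ s ∸ (r ℕ.+ s ℕ.+ k) ∸ 1)
      ≡⟨ cong₂ _+_ (horner-forward #cells (r ℕ.+ s)) (sym (∑-0 too-long (upTo (R ℕ.* S)))) ⟨
    horner #cells (r ℕ.+ s) + 0ℤ
      ≡⟨ trans (ℤ.+-identityʳ _) (#cells-horner 0) ⟩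
    1ℤ * (q * P R S)
      ≡⟨ ℤ.*-identityˡ (q * P R S) ⟩
    q * P R S
      ∎
    where
    r s : ℕ
    r = suc R
    s = suc S
    size : ∀ R S → suc (suc R ℕ.* suc S) ≡ suc R ℕ.+ suc S ℕ.+ R ℕ.* S
    size = ℕ-Solver.solve-∀
    too-long : ∀ k → #cells (r ℕ.+ s ℕ.+ k) * x ^ (r ℕ.+ s ∸ (r ℕ.+ s ℕ.+ k) ∸ 1) ≡ 0ℤ
    too-long k = cong (_* x ^ (r ℕ.+ s ∸ (r ℕ.+ s ℕ.+ k) ∸ 1))
                      (trans (cong #cells (ℕ.+-comm (r ℕ.+ s) k)) (horner-vanish #cells (r ℕ.+ s) (q * P R S) #cells-horner k))

proposition5p7 : (r s : ℕ) → 1 ≤ r → 1 ≤ s → (q : ℤ) → lhs r s q ≡ rhs r s q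
proposition5p7 (suc R) (suc S) _ _ q = trans (Count.lhs≡ R S q) (sym (Polynomials.rhs-closed q R S))
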